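{- Let $\mathbf{M}=(M,\leq_\mathbf{M})$ and $\mathbf{N}=(N,\leq_\mathbf{N})$ be two metrizable echeloned spaces. Then there exist metric spaces $\mathcal{M}=(M,d_M)$ and $\mathcal{N}=(N,d_N)$ inducing $\mathbf{M}$ and $\mathbf{N}$, respectively, such that the set of homomorphisms of echeloned spaces from $\mathbf{M}$ to $\mathbf{N}$ equals the set of all $1$-Lipschitz maps $\mathcal{M}\to\mathcal{N}$ that are homomorphisms from $\mathbf{M}$ to $\mathbf{N}$.
   Context: An echeloned space is a pair $\mathbf{X}=(X,\leq_\mathbf{X})$ where $X$ is a non-empty set and $\leq_\mathbf{X}$ is a total preorder on $X^2$ such that for all $x,y,z\in X$: (a) $(x,x)\leq_\mathbf{X}(y,z)$; (b) if $(y,z)\leq_\mathbf{X}(x,x)$ then $y=z$; (c) $(x,y)\leq_\mathbf{X}(y,x)$. A metric $d$ on $X$ induces the echeloned space $(X,\leq)$ where $(x_1,y_1)\leq(x_2,y_2)\iff d(x_1,y_1)\leq d(x_2,y_2)$; an echeloned space is metrizable if it is induced by some metric. A homomorphism of echeloned spaces $h\colon\mathbf{X}\to\mathbf{Y}$ is a map $h\colon X\to Y$ such that $(x_1,x_2)\leq_\mathbf{X}(y_1,y_2)$ implies $(h(x_1),h(x_2))\leq_\mathbf{Y}(h(y_1),h(y_2))$. -}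

module Defs where

open import Data.Product using (Σ; ∃; _×_; _,_; proj₁; proj₂)
open import Relation.Binary.PropositionalEquality using (_≡_)
open import Relation.Binary.Structures using (IsTotalPreorder; IsTotalOrder)
open import Algebra.Structures using (IsCommutativeRing)
open import Relation.Nullary using (¬_)
open import Function.Bundles using (_⇔_)

-- Agda's standard library has no real numbers, so the theorem is
-- quantified over an arbitrary model of these axioms.

record RealNumbers : Set₁ where
  field
    ℝ       : Set
    _+_ _*_ : ℝ → ℝ → ℝ
    -_      : ℝ → ℝ
    0ℝ 1ℝ   : ℝ
    _≤_     : ℝ → ℝ → Set
    isCommutativeRing : IsCommutativeRing _≡_ _+_ _*_ -_ 0ℝ 1ℝ
    0≢1     : ¬ (0ℝ ≡ 1ℝ)
    inverse : ∀ x → ¬ (x ≡ 0ℝ) → ∃ λ y → x * y ≡ 1ℝ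
    isTotalOrder : IsTotalOrder _≡_ _≤_
    +-mono-≤ : ∀ {x y} z → x ≤ y → (x + z) ≤ (y + z)
    *-nonneg : ∀ {x y} → 0ℝ ≤ x → 0ℝ ≤ y → 0ℝ ≤ (x * y)
    complete : (S : ℝ → Set) → (∃ λ x → S x) →
               (∃ λ b → ∀ x → S x → x ≤ b) →
               ∃ λ s → (∀ x → S x → x ≤ s) ×
                       (∀ b → (∀ x → S x → x ≤ b) → s ≤ b)

record EchelonedSpace : Set₁ where
  field
    X      : Set
    point  : X
    _≼_    : X × X → X × X → Set
    isTotalPreorder : IsTotalPreorder _≡_ _≼_
    ax-a   : ∀ x y z → (x , x) ≼ (y , z)
    ax-b   : ∀ x y z → (y , z) ≼ (x , x) → y ≡ z
    ax-c   : ∀ x y → (x , y) ≼ (y , x)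

open EchelonedSpace

IsHomomorphism : (M N : EchelonedSpace) → (X M → X N) → Set
IsHomomorphism M N h =
  ∀ x₁ x₂ y₁ y₂ → _≼_ M (x₁ , x₂) (y₁ , y₂) →
    _≼_ N (h x₁ , h x₂) (h y₁ , h y₂)

module _ (R : RealNumbers) where
  open RealNumbers R

  record IsMetric (A : Set) (d : A → A → ℝ) : Set where
    field
      nonneg     : ∀ x y → 0ℝ ≤ d x y
      zero⇔equal : ∀ x y → (d x y ≡ 0ℝ) ⇔ (x ≡ y)
      symmetric  : ∀ x y → d x y ≡ d y x
      triangle   : ∀ x y z → d x z ≤ (d x y + d y z)

  Induces : (M : EchelonedSpace) → (X M → X M → ℝ) → Set
  Induces M d = ∀ x₁ y₁ x₂ y₂ →
    _≼_ M (x₁ , y₁) (x₂ , y₂) ⇔ (d x₁ y₁ ≤ d x₂ y₂)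

  Metrizable : EchelonedSpace → Set
  Metrizable M = ∃ λ d → IsMetric (X M) d × Induces M d

  OneLipschitz : {A B : Set} → (A → A → ℝ) → (B → B → ℝ) → (A → B) → Set
  OneLipschitz dA dB h = ∀ x y → dB (h x) (h y) ≤ dA x y

module Submission where

-- Add the discrete metric to the metric of M, so that distinct points lie at distance ≥ 1, and
-- replace the metric d of N by d / (1 + d), which is ≤ 1. Both changes preserve and reflect the
-- order of distances, so they induce the same echeloned spaces, and now every map M → N is
-- 1-Lipschitz. Completeness of ℝ supplies the two classical principles needed: ¬ P ⊎ ¬ ¬ P to
-- define the discrete metric, and ¬¬-stability of ≤ for the Lipschitz bound.

open import Defs
open import Algebra.Bundles using (CommutativeRing)
open import Data.Empty using (⊥-elim)
open import Data.Product using (∃; _×_; _,_; proj₁; proj₂)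
open import Data.Sum using (_⊎_; inj₁; inj₂)
open import Function.Bundles using (_⇔_; mk⇔; Equivalence)
open import Function.Construct.Composition using (_⇔-∘_)
open import Level using (0ℓ)
open import Relation.Binary.PropositionalEquality
  using (_≡_; refl; sym; trans; cong; cong₂; subst; subst₂; module ≡-Reasoning)
open import Relation.Binary.Bundles using (TotalOrder)
import Relation.Binary.Reasoning.PartialOrder as PartialOrderReasoning
open import Relation.Binary.Structures using (IsTotalOrder)
open import Relation.Nullary using (¬_; Stable)

module RealProperties (R : RealNumbers) where

  open RealNumbers R public
    renaming ( _+_ to infixl 6 _+_ ; _*_ to infixl 7 _*_ ; -_ to infix 8 -_
             ; _≤_ to infix 4 _≤_ ; +-mono-≤ to +-monoˡ-≤ )

  ℝ-commutativeRing : CommutativeRing 0ℓ 0ℓ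
  ℝ-commutativeRing = record
    { Carrier = ℝ ; _≈_ = _≡_ ; _+_ = _+_ ; _*_ = _*_ ; -_ = -_
    ; 0# = 0ℝ ; 1# = 1ℝ ; isCommutativeRing = isCommutativeRing }

  open CommutativeRing ℝ-commutativeRing public
    using ( _-_ ; +-assoc ; +-comm ; +-identityˡ ; +-identityʳ ; -‿inverseˡ ; -‿inverseʳ
          ; *-assoc ; *-comm ; *-identityˡ ; *-identityʳ ; distribʳ ; zeroˡ )
  open import Algebra.Properties.Ring (CommutativeRing.ring ℝ-commutativeRing) public
    using (-‿involutive ; -0#≈0# ; -‿distribˡ-* ; -‿distribʳ-*)
  open import Algebra.Properties.CommutativeSemigroup
    (CommutativeRing.+-commutativeSemigroup ℝ-commutativeRing) public
    using (interchange)
  open IsTotalOrder isTotalOrder public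
    using (total)
    renaming (refl to ≤-refl; trans to ≤-trans; antisym to ≤-antisym; reflexive to ≤-reflexive)

  ≤-totalOrder : TotalOrder 0ℓ 0ℓ 0ℓ
  ≤-totalOrder = record { Carrier = ℝ ; _≈_ = _≡_ ; _≤_ = _≤_ ; isTotalOrder = isTotalOrder }

  module ≤-Reasoning = PartialOrderReasoning (TotalOrder.poset ≤-totalOrder)

  open ≡-Reasoning

  x+y-y≡x : ∀ x y → x + y - y ≡ x
  x+y-y≡x x y = begin
    x + y - y     ≡⟨ +-assoc x y (- y) ⟩
    x + (y - y)   ≡⟨ cong (x +_) (-‿inverseʳ y) ⟩
    x + 0ℝ        ≡⟨ +-identityʳ x ⟩
    x             ∎

  +-monoʳ-≤ : ∀ {x y} z → x ≤ y → z + x ≤ z + y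
  +-monoʳ-≤ {x} {y} z p = subst₂ _≤_ (+-comm x z) (+-comm y z) (+-monoˡ-≤ z p)

  +-mono-≤ : ∀ {a b c d} → a ≤ b → c ≤ d → a + c ≤ b + d
  +-mono-≤ {b = b} {c = c} p q = ≤-trans (+-monoˡ-≤ c p) (+-monoʳ-≤ b q)

  +-cancelʳ-≤ : ∀ {x y} z → x + z ≤ y + z → x ≤ y
  +-cancelʳ-≤ {x} {y} z p = subst₂ _≤_ (x+y-y≡x x z) (x+y-y≡x y z) (+-monoˡ-≤ (- z) p)

  +-cancelˡ-≤ : ∀ {x y} z → z + x ≤ z + y → x ≤ y
  +-cancelˡ-≤ {x} {y} z p = +-cancelʳ-≤ z (subst₂ _≤_ (+-comm z x) (+-comm z y) p)

  +-nonNeg : ∀ {x y} → 0ℝ ≤ x → 0ℝ ≤ y → 0ℝ ≤ x + y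
  +-nonNeg p q = subst (_≤ _) (+-identityˡ 0ℝ) (+-mono-≤ p q)

  x≤x+y : ∀ x {y} → 0ℝ ≤ y → x ≤ x + y
  x≤x+y x {y} p = subst (_≤ x + y) (+-identityʳ x) (+-monoʳ-≤ x p)

  x+[-x+y]≡y : ∀ x y → x + (- x + y) ≡ y
  x+[-x+y]≡y x y = begin
    x + (- x + y)   ≡⟨ +-assoc x (- x) y ⟨
    x - x + y       ≡⟨ cong (_+ y) (-‿inverseʳ x) ⟩
    0ℝ + y          ≡⟨ +-identityˡ y ⟩
    y               ∎

  neg-mono-≤ : ∀ {x y} → x ≤ y → - y ≤ - x
  neg-mono-≤ {x} {y} p = subst₂ _≤_ (x+[-x+y]≡y x (- y)) y-x-y≡-x (+-monoˡ-≤ (- x + - y) p)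
    where
    y-x-y≡-x : y + (- x + - y) ≡ - x
    y-x-y≡-x = trans (cong (y +_) (+-comm (- x) (- y))) (x+[-x+y]≡y y (- x))

  x-y+y≡x : ∀ x y → x - y + y ≡ x
  x-y+y≡x x y = begin
    x - y + y     ≡⟨ +-assoc x (- y) y ⟩
    x + (- y + y) ≡⟨ cong (x +_) (-‿inverseˡ y) ⟩
    x + 0ℝ        ≡⟨ +-identityʳ x ⟩
    x             ∎

  x≤y⇒0≤y-x : ∀ {x y} → x ≤ y → 0ℝ ≤ y - x
  x≤y⇒0≤y-x {x} {y} p = subst (_≤ y - x) (-‿inverseʳ x) (+-monoˡ-≤ (- x) p)

  0≤y-x⇒x≤y : ∀ {x y} → 0ℝ ≤ y - x → x ≤ y
  0≤y-x⇒x≤y {x} {y} p = subst₂ _≤_ (+-identityˡ x) (x-y+y≡x y x) (+-monoˡ-≤ x p)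

  x≤y⇒x-y≤0 : ∀ {x y} → x ≤ y → x - y ≤ 0ℝ
  x≤y⇒x-y≤0 {x} {y} p = subst (x - y ≤_) (-‿inverseʳ y) (+-monoˡ-≤ (- y) p)

  x-y≤0⇒x≤y : ∀ {x y} → x - y ≤ 0ℝ → x ≤ y
  x-y≤0⇒x≤y {x} {y} p = subst₂ _≤_ (x-y+y≡x x y) (+-identityˡ y) (+-monoˡ-≤ y p)

  0≤-x⇒x≤0 : ∀ {x} → 0ℝ ≤ - x → x ≤ 0ℝ
  0≤-x⇒x≤0 {x} p = subst₂ _≤_ (-‿involutive x) -0#≈0# (neg-mono-≤ p)

  x≤0⇒0≤-x : ∀ {x} → x ≤ 0ℝ → 0ℝ ≤ - x
  x≤0⇒0≤-x p = subst (_≤ _) -0#≈0# (neg-mono-≤ p)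

  neg-cancel-≤ : ∀ {x y} → - x ≤ - y → y ≤ x
  neg-cancel-≤ {x} {y} p = subst₂ _≤_ (-‿involutive y) (-‿involutive x) (neg-mono-≤ p)

  x-y≤x : ∀ x {y} → 0ℝ ≤ y → x - y ≤ x
  x-y≤x x {y} p =
    subst (x - y ≤_) (+-identityʳ x) (+-monoʳ-≤ x (subst (- y ≤_) -0#≈0# (neg-mono-≤ p)))

  0≤1 : 0ℝ ≤ 1ℝ
  0≤1 with total 0ℝ 1ℝ
  ... | inj₁ 0≤1 = 0≤1
  ... | inj₂ 1≤0 = subst (0ℝ ≤_) [-1]*[-1]≡1 (*-nonneg 0≤-1 0≤-1)
    where
    0≤-1 : 0ℝ ≤ - 1ℝ
    0≤-1 = x≤0⇒0≤-x 1≤0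
    [-1]*[-1]≡1 : - 1ℝ * - 1ℝ ≡ 1ℝ
    [-1]*[-1]≡1 = begin
      - 1ℝ * - 1ℝ    ≡⟨ -‿distribˡ-* 1ℝ (- 1ℝ) ⟨
      - (1ℝ * - 1ℝ)  ≡⟨ cong -_ (*-identityˡ (- 1ℝ)) ⟩
      - - 1ℝ         ≡⟨ -‿involutive 1ℝ ⟩
      1ℝ             ∎

  1≰0 : ¬ (1ℝ ≤ 0ℝ)
  1≰0 1≤0 = 0≢1 (≤-antisym 0≤1 1≤0)

  *-monoˡ-≤-nonNeg : ∀ {x y z} → 0ℝ ≤ z → x ≤ y → x * z ≤ y * z
  *-monoˡ-≤-nonNeg {x} {y} {z} 0≤z x≤y =
    0≤y-x⇒x≤y (subst (0ℝ ≤_) [y-x]z≡yz-xz (*-nonneg (x≤y⇒0≤y-x x≤y) 0≤z))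
    where
    [y-x]z≡yz-xz : (y - x) * z ≡ y * z - x * z
    [y-x]z≡yz-xz = trans (distribʳ z y (- x)) (cong (y * z +_) (sym (-‿distribˡ-* x z)))

  *-monoʳ-≤-nonNeg : ∀ {x y z} → 0ℝ ≤ z → x ≤ y → z * x ≤ z * y
  *-monoʳ-≤-nonNeg {x} {y} {z} 0≤z x≤y =
    subst₂ _≤_ (*-comm x z) (*-comm y z) (*-monoˡ-≤-nonNeg 0≤z x≤y)

  x≤0⇒y≤0⇒x+y≤0 : ∀ {x y} → x ≤ 0ℝ → y ≤ 0ℝ → x + y ≤ 0ℝ
  x≤0⇒y≤0⇒x+y≤0 {x} {y} x≤0 y≤0 = subst (x + y ≤_) (+-identityˡ 0ℝ) (+-mono-≤ x≤0 y≤0)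

  x+y≡0⇒x≡0 : ∀ {x y} → 0ℝ ≤ x → 0ℝ ≤ y → x + y ≡ 0ℝ → x ≡ 0ℝ
  x+y≡0⇒x≡0 {x} 0≤x 0≤y x+y≡0 = ≤-antisym (subst (x ≤_) x+y≡0 (x≤x+y x 0≤y)) 0≤x

  +-mono-⇔ : ∀ {a b c e} → (a ≤ b → c ≤ e) → (b ≤ a → e ≤ c) → a ≤ b ⇔ a + c ≤ b + e
  +-mono-⇔ {a} {b} {c} {e} c≤e e≤c = mk⇔ (λ a≤b → +-mono-≤ a≤b (c≤e a≤b)) from
    where
    from : a + c ≤ b + e → a ≤ b
    from a+c≤b+e with total a b
    ... | inj₁ a≤b = a≤b
    ... | inj₂ b≤a = +-cancelʳ-≤ c (≤-trans a+c≤b+e (+-monoʳ-≤ b (e≤c b≤a)))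

  LeastUpperBound : (ℝ → Set) → ℝ → Set
  LeastUpperBound S s = (∀ x → S x → x ≤ s) × (∀ b → (∀ x → S x → x ≤ b) → s ≤ b)

  -- The supremum s of S satisfies s ≤ s - c: adding c to an element of S stays in S as long as
  -- the sum is ≤ 1, and ¬¬(c ≤ 0) rules out overshooting 1.
  nonPos-stable : ∀ {c} → Stable (c ≤ 0ℝ)
  nonPos-stable {c} ¬¬c≤0 =
    conclude (complete S (0ℝ , 0≤1 , λ ¬0≤0 → ¬0≤0 ≤-refl) (1ℝ , λ _ → proj₁))
    where
    S : ℝ → Set
    S t = t ≤ 1ℝ × ¬ ¬ (t ≤ 0ℝ)

    ¬¬t+c≤0 : ∀ {t} → ¬ ¬ (t ≤ 0ℝ) → ¬ ¬ (t + c ≤ 0ℝ)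
    ¬¬t+c≤0 ¬¬t≤0 t+c≰0 = ¬¬t≤0 λ t≤0 → ¬¬c≤0 λ c≤0 → t+c≰0 (x≤0⇒y≤0⇒x+y≤0 t≤0 c≤0)

    shift-bound : ∀ {s} → LeastUpperBound S s → ∀ t → S t → t ≤ s - c
    shift-bound {s} (upper , _) t (t≤1 , ¬¬t≤0) with total (t + c) 1ℝ
    ... | inj₁ t+c≤1 =
      subst (_≤ s - c) (x+y-y≡x t c)
            (+-monoˡ-≤ (- c) (upper (t + c) (t+c≤1 , ¬¬t+c≤0 ¬¬t≤0)))
    ... | inj₂ 1≤t+c = ⊥-elim (¬¬t+c≤0 ¬¬t≤0 λ t+c≤0 → 1≰0 (≤-trans 1≤t+c t+c≤0))

    conclude : ∃ (LeastUpperBound S) → c ≤ 0ℝ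
    conclude (s , lub@(_ , least)) = 0≤-x⇒x≤0 (+-cancelˡ-≤ s
      (subst (_≤ s - c) (sym (+-identityʳ s)) (least (s - c) (shift-bound lub))))

  ≤-stable : ∀ {x y} → Stable (x ≤ y)
  ≤-stable ¬¬x≤y = x-y≤0⇒x≤y (nonPos-stable λ k → ¬¬x≤y λ x≤y → k (x≤y⇒x-y≤0 x≤y))

  -- The supremum of {0} ∪ {2 | ¬ P} is 0 if P holds and 2 if ¬ P holds; compare it with 1.
  weak-excluded-middle : (P : Set) → ¬ P ⊎ ¬ ¬ P
  weak-excluded-middle P = decide (complete S (0ℝ , inj₁ refl) (2ℝ , bounded))
    where
    2ℝ : ℝ
    2ℝ = 1ℝ + 1ℝ

    S : ℝ → Set
    S t = t ≡ 0ℝ ⊎ (t ≡ 2ℝ × ¬ P)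

    bounded : ∀ t → S t → t ≤ 2ℝ
    bounded t (inj₁ refl) = +-nonNeg 0≤1 0≤1
    bounded t (inj₂ (refl , _)) = ≤-refl

    decide : ∃ (LeastUpperBound S) → ¬ P ⊎ ¬ ¬ P
    decide (s , upper , least) with total s 1ℝ
    ... | inj₁ s≤1 = inj₂ λ ¬p → 1≰0 (+-cancelˡ-≤ 1ℝ
      (subst (2ℝ ≤_) (sym (+-identityʳ 1ℝ)) (≤-trans (upper 2ℝ (inj₂ (refl , ¬p))) s≤1)))
    ... | inj₂ 1≤s = inj₁ λ p → 1≰0 (≤-trans 1≤s (least 0ℝ λ
      { t (inj₁ t≡0) → ≤-reflexive t≡0
      ; t (inj₂ (_ , ¬p)) → ⊥-elim (¬p p)
      }))

  inverse-unique : ∀ {u y y′} → u * y ≡ 1ℝ → u * y′ ≡ 1ℝ → y ≡ y′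
  inverse-unique {u} {y} {y′} uy≡1 uy′≡1 = begin
    y             ≡⟨ *-identityʳ y ⟨
    y * 1ℝ        ≡⟨ cong (y *_) uy′≡1 ⟨
    y * (u * y′)  ≡⟨ *-assoc y u y′ ⟨
    y * u * y′    ≡⟨ cong (_* y′) (trans (*-comm y u) uy≡1) ⟩
    1ℝ * y′       ≡⟨ *-identityˡ y′ ⟩
    y′            ∎

  inverse-nonNeg : ∀ {u y} → 0ℝ ≤ u → u * y ≡ 1ℝ → 0ℝ ≤ y
  inverse-nonNeg {u} {y} 0≤u uy≡1 with total 0ℝ y
  ... | inj₁ 0≤y = 0≤y
  ... | inj₂ y≤0 = ⊥-elim (1≰0 (0≤-x⇒x≤0 0≤-1))
    where
    0≤-1 : 0ℝ ≤ - 1ℝ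
    0≤-1 = subst (0ℝ ≤_) (trans (sym (-‿distribʳ-* u y)) (cong -_ uy≡1))
                 (*-nonneg 0≤u (x≤0⇒0≤-x y≤0))

  inverse-cancelˡ : ∀ {u u′} w → u * u′ ≡ 1ℝ → u * (u′ * w) ≡ w
  inverse-cancelˡ {u} {u′} w uu′≡1 = begin
    u * (u′ * w)  ≡⟨ *-assoc u u′ w ⟨
    u * u′ * w    ≡⟨ cong (_* w) uu′≡1 ⟩
    1ℝ * w        ≡⟨ *-identityˡ w ⟩
    w             ∎

  inverse-antitone : ∀ {u v u′ v′} → 0ℝ ≤ u′ → 0ℝ ≤ v′ →
                     u * u′ ≡ 1ℝ → v * v′ ≡ 1ℝ → u ≤ v → v′ ≤ u′
  inverse-antitone {u} {v} {u′} {v′} 0≤u′ 0≤v′ uu′≡1 vv′≡1 u≤v = subst₂ _≤_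
    (inverse-cancelˡ v′ uu′≡1)
    (trans (cong (v *_) (*-comm u′ v′)) (inverse-cancelˡ u′ vv′≡1))
    (*-monoˡ-≤-nonNeg (*-nonneg 0≤u′ 0≤v′) u≤v)

module Shrink (R : RealNumbers) where

  open RealProperties R

  1+a≢0 : ∀ {a} → 0ℝ ≤ a → ¬ (1ℝ + a ≡ 0ℝ)
  1+a≢0 0≤a 1+a≡0 = 1≰0 (subst (1ℝ ≤_) 1+a≡0 (x≤x+y 1ℝ 0≤a))

  recip1+ : (a : ℝ) → 0ℝ ≤ a → ℝ
  recip1+ a 0≤a = proj₁ (inverse (1ℝ + a) (1+a≢0 0≤a))

  recip1+-inverse : ∀ {a} (0≤a : 0ℝ ≤ a) → (1ℝ + a) * recip1+ a 0≤a ≡ 1ℝ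
  recip1+-inverse {a} 0≤a = proj₂ (inverse (1ℝ + a) (1+a≢0 0≤a))

  recip1+-nonNeg : ∀ {a} (0≤a : 0ℝ ≤ a) → 0ℝ ≤ recip1+ a 0≤a
  recip1+-nonNeg 0≤a = inverse-nonNeg (+-nonNeg 0≤1 0≤a) (recip1+-inverse 0≤a)

  recip1+-antitone : ∀ {a b} (0≤a : 0ℝ ≤ a) (0≤b : 0ℝ ≤ b) →
                     a ≤ b → recip1+ b 0≤b ≤ recip1+ a 0≤a
  recip1+-antitone 0≤a 0≤b a≤b =
    inverse-antitone (recip1+-nonNeg 0≤a) (recip1+-nonNeg 0≤b)
      (recip1+-inverse 0≤a) (recip1+-inverse 0≤b) (+-monoʳ-≤ 1ℝ a≤b)

  recip1+-cancel-≤ : ∀ {a b} (0≤a : 0ℝ ≤ a) (0≤b : 0ℝ ≤ b) →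
                     recip1+ b 0≤b ≤ recip1+ a 0≤a → a ≤ b
  recip1+-cancel-≤ {a} {b} 0≤a 0≤b rb≤ra = +-cancelˡ-≤ 1ℝ
    (inverse-antitone (+-nonNeg 0≤1 0≤b) (+-nonNeg 0≤1 0≤a)
      (trans (*-comm _ _) (recip1+-inverse 0≤b)) (trans (*-comm _ _) (recip1+-inverse 0≤a))
      rb≤ra)

  shrink : (a : ℝ) → 0ℝ ≤ a → ℝ
  shrink a 0≤a = a * recip1+ a 0≤a

  shrink≡1-recip1+ : ∀ {a} (0≤a : 0ℝ ≤ a) → shrink a 0≤a ≡ 1ℝ - recip1+ a 0≤a
  shrink≡1-recip1+ {a} 0≤a = begin
    a * r               ≡⟨ x+y-y≡x (a * r) r ⟨
    a * r + r - r       ≡⟨ cong (_- r) (+-comm (a * r) r) ⟩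
    r + a * r - r       ≡⟨ cong (λ t → t + a * r - r) (*-identityˡ r) ⟨
    1ℝ * r + a * r - r  ≡⟨ cong (_- r) (distribʳ r 1ℝ a) ⟨
    (1ℝ + a) * r - r    ≡⟨ cong (_- r) (recip1+-inverse 0≤a) ⟩
    1ℝ - r              ∎
    where
    r = recip1+ a 0≤a
    open ≡-Reasoning

  shrink-cong : ∀ {a b} → a ≡ b → (0≤a : 0ℝ ≤ a) (0≤b : 0ℝ ≤ b) →
                shrink a 0≤a ≡ shrink b 0≤b
  shrink-cong {a} refl 0≤a 0≤a′ =
    cong (a *_) (inverse-unique (recip1+-inverse 0≤a) (recip1+-inverse 0≤a′))

  shrink-mono-⇔ : ∀ {a b} (0≤a : 0ℝ ≤ a) (0≤b : 0ℝ ≤ b) →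
                  a ≤ b ⇔ shrink a 0≤a ≤ shrink b 0≤b
  shrink-mono-⇔ 0≤a 0≤b = mk⇔
    (λ a≤b → subst₂ _≤_ (sym (shrink≡1-recip1+ 0≤a)) (sym (shrink≡1-recip1+ 0≤b))
               (+-monoʳ-≤ 1ℝ (neg-mono-≤ (recip1+-antitone 0≤a 0≤b a≤b))))
    (λ sa≤sb → recip1+-cancel-≤ 0≤a 0≤b (neg-cancel-≤ (+-cancelˡ-≤ 1ℝ
               (subst₂ _≤_ (shrink≡1-recip1+ 0≤a) (shrink≡1-recip1+ 0≤b) sa≤sb))))

  shrink≡0⇔ : ∀ {a} (0≤a : 0ℝ ≤ a) → shrink a 0≤a ≡ 0ℝ ⇔ a ≡ 0ℝ
  shrink≡0⇔ {a} 0≤a = mk⇔ to (λ a≡0 → trans (cong (_* r) a≡0) (zeroˡ r))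
    where
    r = recip1+ a 0≤a
    r[1+a]≡1 : r * (1ℝ + a) ≡ 1ℝ
    r[1+a]≡1 = trans (*-comm r (1ℝ + a)) (recip1+-inverse 0≤a)
    open ≡-Reasoning
    to : a * r ≡ 0ℝ → a ≡ 0ℝ
    to ar≡0 = begin
      a                    ≡⟨ *-identityʳ a ⟨
      a * 1ℝ               ≡⟨ cong (a *_) r[1+a]≡1 ⟨
      a * (r * (1ℝ + a))   ≡⟨ *-assoc a r (1ℝ + a) ⟨
      a * r * (1ℝ + a)     ≡⟨ cong (_* (1ℝ + a)) ar≡0 ⟩
      0ℝ * (1ℝ + a)        ≡⟨ zeroˡ (1ℝ + a) ⟩
      0ℝ                   ∎

  shrink-nonNeg : ∀ {a} (0≤a : 0ℝ ≤ a) → 0ℝ ≤ shrink a 0≤a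
  shrink-nonNeg 0≤a = *-nonneg 0≤a (recip1+-nonNeg 0≤a)

  shrink≤1 : ∀ {a} (0≤a : 0ℝ ≤ a) → shrink a 0≤a ≤ 1ℝ
  shrink≤1 0≤a = subst (_≤ 1ℝ) (sym (shrink≡1-recip1+ 0≤a)) (x-y≤x 1ℝ (recip1+-nonNeg 0≤a))

  shrink-subadditive : ∀ {a b c} (0≤a : 0ℝ ≤ a) (0≤b : 0ℝ ≤ b) (0≤c : 0ℝ ≤ c) →
                       c ≤ a + b → shrink c 0≤c ≤ shrink a 0≤a + shrink b 0≤b
  shrink-subadditive {a} {b} {c} 0≤a 0≤b 0≤c c≤a+b = begin
    shrink c 0≤c                 ≤⟨ Equivalence.to (shrink-mono-⇔ 0≤c 0≤a+b) c≤a+b ⟩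
    (a + b) * r                  ≡⟨ distribʳ r a b ⟩
    a * r + b * r                ≤⟨ +-mono-≤ (*-monoʳ-≤-nonNeg 0≤a ra+b≤ra)
                                             (*-monoʳ-≤-nonNeg 0≤b ra+b≤rb) ⟩
    shrink a 0≤a + shrink b 0≤b  ∎
    where
    0≤a+b : 0ℝ ≤ a + b
    0≤a+b = +-nonNeg 0≤a 0≤b
    r = recip1+ (a + b) 0≤a+b
    ra+b≤ra : r ≤ recip1+ a 0≤a
    ra+b≤ra = recip1+-antitone 0≤a 0≤a+b (x≤x+y a 0≤b)
    ra+b≤rb : r ≤ recip1+ b 0≤b
    ra+b≤rb = recip1+-antitone 0≤b 0≤a+b (subst (b ≤_) (+-comm b a) (x≤x+y b 0≤a))
    open ≤-Reasoning

module Metrics (R : RealNumbers) where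

  open RealProperties R
  open Shrink R

  OrderEquivalent : {A : Set} → (A → A → ℝ) → (A → A → ℝ) → Set
  OrderEquivalent d d′ = ∀ x y x′ y′ → d x y ≤ d x′ y′ ⇔ d′ x y ≤ d′ x′ y′

  induces-transport : ∀ {M d d′} → Induces R M d → OrderEquivalent d d′ → Induces R M d′
  induces-transport ind d≈d′ x y x′ y′ = d≈d′ x y x′ y′ ⇔-∘ ind x y x′ y′

  -- Classically the discrete metric; constructively it is 1 on points that are provably distinct
  -- and 0 on points that are not (¬ ¬ x ≡ y), so it is only a pseudometric.
  discrete : {A : Set} → A → A → ℝ
  discrete x y with weak-excluded-middle (x ≡ y)
  ... | inj₁ _ = 1ℝ
  ... | inj₂ _ = 0ℝ

  module _ {A : Set} where

    discrete-≢ : ∀ {x y : A} → ¬ x ≡ y → discrete x y ≡ 1ℝ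
    discrete-≢ {x} {y} x≢y with weak-excluded-middle (x ≡ y)
    ... | inj₁ _ = refl
    ... | inj₂ ¬¬x≡y = ⊥-elim (¬¬x≡y x≢y)

    discrete-≡ : ∀ {x y : A} → ¬ ¬ x ≡ y → discrete x y ≡ 0ℝ
    discrete-≡ {x} {y} ¬¬x≡y with weak-excluded-middle (x ≡ y)
    ... | inj₁ x≢y = ⊥-elim (¬¬x≡y x≢y)
    ... | inj₂ _ = refl

    discrete-nonNeg : ∀ (x y : A) → 0ℝ ≤ discrete x y
    discrete-nonNeg x y with weak-excluded-middle (x ≡ y)
    ... | inj₁ _ = 0≤1
    ... | inj₂ _ = ≤-refl

    discrete≤1 : ∀ (x y : A) → discrete x y ≤ 1ℝ
    discrete≤1 x y with weak-excluded-middle (x ≡ y)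
    ... | inj₁ _ = ≤-refl
    ... | inj₂ _ = 0≤1

    discrete-sym : ∀ (x y : A) → discrete x y ≡ discrete y x
    discrete-sym x y with weak-excluded-middle (x ≡ y)
    ... | inj₁ x≢y = sym (discrete-≢ λ y≡x → x≢y (sym y≡x))
    ... | inj₂ ¬¬x≡y = sym (discrete-≡ λ y≢x → ¬¬x≡y λ x≡y → y≢x (sym x≡y))

    discrete-triangle : ∀ (x y z : A) → discrete x z ≤ discrete x y + discrete y z
    discrete-triangle x y z with weak-excluded-middle (x ≡ z)
    ... | inj₂ _ = +-nonNeg (discrete-nonNeg x y) (discrete-nonNeg y z)
    ... | inj₁ x≢z = apart (weak-excluded-middle (x ≡ y))
      where
      apart : ¬ x ≡ y ⊎ ¬ ¬ x ≡ y → 1ℝ ≤ discrete x y + discrete y z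
      apart (inj₁ x≢y) = subst (1ℝ ≤_) (cong (_+ discrete y z) (sym (discrete-≢ x≢y)))
                               (x≤x+y 1ℝ (discrete-nonNeg y z))
      apart (inj₂ ¬¬x≡y) = ≤-reflexive (sym (begin
        discrete x y + discrete y z ≡⟨ cong₂ _+_ (discrete-≡ ¬¬x≡y) (discrete-≢ y≢z) ⟩
        0ℝ + 1ℝ                     ≡⟨ +-identityˡ 1ℝ ⟩
        1ℝ                          ∎))
        where
        open ≡-Reasoning
        y≢z : ¬ y ≡ z
        y≢z y≡z = ¬¬x≡y λ x≡y → x≢z (trans x≡y y≡z)

  module _ {A : Set} {d : A → A → ℝ} (isMetric : IsMetric R A d) where

    open IsMetric isMetric

    discrete-monotone : ∀ {x y x′ y′} → d x y ≤ d x′ y′ → discrete x y ≤ discrete x′ y′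
    discrete-monotone {x} {y} {x′} {y′} dxy≤dx′y′ with weak-excluded-middle (x′ ≡ y′)
    ... | inj₁ _ = discrete≤1 x y
    ... | inj₂ ¬¬x′≡y′ = ≤-reflexive (discrete-≡ ¬¬x≡y)
      where
      ¬¬x≡y : ¬ ¬ x ≡ y
      ¬¬x≡y x≢y = ¬¬x′≡y′ λ x′≡y′ → x≢y (Equivalence.to (zero⇔equal x y) (≤-antisym
        (subst (d x y ≤_) (Equivalence.from (zero⇔equal x′ y′) x′≡y′) dxy≤dx′y′) (nonneg x y)))

    separated : A → A → ℝ
    separated x y = d x y + discrete x y

    separated-isMetric : IsMetric R A separated
    separated-isMetric = record
      { nonneg = λ x y → +-nonNeg (nonneg x y) (discrete-nonNeg x y)
      ; zero⇔equal = λ x y → mk⇔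
          (λ sxy≡0 → Equivalence.to (zero⇔equal x y)
                       (x+y≡0⇒x≡0 (nonneg x y) (discrete-nonNeg x y) sxy≡0))
          (λ x≡y → trans (cong₂ _+_ (Equivalence.from (zero⇔equal x y) x≡y)
                                    (discrete-≡ λ x≢y → x≢y x≡y))
                         (+-identityˡ 0ℝ))
      ; symmetric = λ x y → cong₂ _+_ (symmetric x y) (discrete-sym x y)
      ; triangle = λ x y z → subst (separated x z ≤_)
          (interchange (d x y) (d y z) (discrete x y) (discrete y z))
          (+-mono-≤ (triangle x y z) (discrete-triangle x y z))
      }

    separated-orderEquivalent : OrderEquivalent d separated
    separated-orderEquivalent _ _ _ _ = +-mono-⇔ discrete-monotone discrete-monotone

    separated-≢ : ∀ {x y} → ¬ x ≡ y → 1ℝ ≤ separated x y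
    separated-≢ {x} {y} x≢y = subst (λ j → 1ℝ ≤ d x y + j) (sym (discrete-≢ x≢y))
                                    (subst (1ℝ ≤_) (+-comm 1ℝ (d x y)) (x≤x+y 1ℝ (nonneg x y)))

    bounded : A → A → ℝ
    bounded x y = shrink (d x y) (nonneg x y)

    bounded-isMetric : IsMetric R A bounded
    bounded-isMetric = record
      { nonneg = λ x y → shrink-nonNeg (nonneg x y)
      ; zero⇔equal = λ x y → zero⇔equal x y ⇔-∘ shrink≡0⇔ (nonneg x y)
      ; symmetric = λ x y → shrink-cong (symmetric x y) (nonneg x y) (nonneg y x)
      ; triangle = λ x y z →
          shrink-subadditive (nonneg x y) (nonneg y z) (nonneg x z) (triangle x y z)
      }

    bounded-orderEquivalent : OrderEquivalent d bounded
    bounded-orderEquivalent x y x′ y′ = shrink-mono-⇔ (nonneg x y) (nonneg x′ y′)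

    bounded≤1 : ∀ x y → bounded x y ≤ 1ℝ
    bounded≤1 x y = shrink≤1 (nonneg x y)

  every-map-oneLipschitz : ∀ {A B} {dA : A → A → ℝ} {dB : B → B → ℝ} →
    IsMetric R A dA → IsMetric R B dB →
    (∀ {x y} → ¬ x ≡ y → 1ℝ ≤ dA x y) → (∀ u v → dB u v ≤ 1ℝ) →
    ∀ h → OneLipschitz R dA dB h
  every-map-oneLipschitz {dA = dA} {dB = dB} dA-metric dB-metric dA≥1 dB≤1 h x y =
    ≤-stable λ dB≰dA →
      dB≰dA (≤-trans (dB≤1 (h x) (h y)) (dA≥1 λ x≡y → dB≰dA (equal-points x≡y)))
    where
    equal-points : x ≡ y → dB (h x) (h y) ≤ dA x y
    equal-points x≡y = subst (_≤ dA x y)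
      (sym (Equivalence.from (IsMetric.zero⇔equal dB-metric (h x) (h y)) (cong h x≡y)))
      (IsMetric.nonneg dA-metric x y)

proposition1p12 : (R : RealNumbers) (M N : EchelonedSpace) →
    Metrizable R M → Metrizable R N →
    ∃ λ dM → ∃ λ dN →
    IsMetric R (EchelonedSpace.X M) dM × Induces R M dM ×
    IsMetric R (EchelonedSpace.X N) dN × Induces R N dN ×
    (∀ (h : EchelonedSpace.X M → EchelonedSpace.X N) →
    IsHomomorphism M N h ⇔ (OneLipschitz R dM dN h × IsHomomorphism M N h))
proposition1p12 R M N (dM , dM-metric , dM-induces) (dN , dN-metric , dN-induces) =
  separated dM-metric , bounded dN-metric ,
  separated-isMetric dM-metric ,
  induces-transport {M} dM-induces (separated-orderEquivalent dM-metric) ,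
  bounded-isMetric dN-metric ,
  induces-transport {N} dN-induces (bounded-orderEquivalent dN-metric) ,
  λ h → mk⇔ (λ hom → oneLipschitz h , hom) proj₂
  where
  open Metrics R
  oneLipschitz : ∀ h → OneLipschitz R (separated dM-metric) (bounded dN-metric) h
  oneLipschitz = every-map-oneLipschitz (separated-isMetric dM-metric) (bounded-isMetric dN-metric)
                   (separated-≢ dM-metric) (bounded≤1 dN-metric)
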